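{- Let $G$ be a (finite, connected) induced subgraph of the grid graph, and let $G'$ be obtained from $G$ by gluing a line of length $1$ to a corner node of $G$ which is $1$-suitable. Then $G'$ is not $12$-representable.
   Context: The grid graph is the infinite graph on $\mathbb{Z}^2$ with vertices adjacent iff at Euclidean distance $1$. A square of an induced subgraph $H$ of it is a set of four vertices of $H$ of the form $\{(x,y),(x+1,y),(x,y+1),(x+1,y+1)\}$. A square $S$ is an end-square if it has an edge $ab$ such that neither $a$ nor $b$ is a vertex of a square other than $S$. A corner node is a node that belongs to exactly one square, where this square is not an end-square and shares an edge with each of two other squares. Gluing a line of length $1$ to a node $v$ means adding a new vertex $u$ and the edge $vu$; $v$ is $1$-suitable if this can be done so that the result is again an induced subgraph of the grid graph, and $G'$ denotes such a result. A labeled graph has distinct positive integers as vertices. A labeled graph $G=(V,E)$ is $12$-representable if there is a word $w$ whose set of letters is $V$ such that for all distinct $x,y\in V$: $xy\notin E$ iff some occurrence of $\min(x,y)$ precedes some occurrence of $\max(x,y)$ in $w$. An unlabeled graph is $12$-representable if some labeling of it is $12$-representable. -}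

module Defs where

open import Data.Nat using (ℕ; _<_; _⊓_; _⊔_)
open import Data.Integer as ℤ using (ℤ; ∣_∣; _-_; +_)
open import Data.Product using (Σ; ∃; ∃-syntax; _×_; _,_)
open import Data.List using (List; []; _∷_; _++_)
open import Data.List.Membership.Propositional using (_∈_; _∉_)
open import Relation.Binary.PropositionalEquality using (_≡_; _≢_)
open import Relation.Nullary using (¬_)
open import Function.Bundles using (_⇔_)

Precedes : ℕ → ℕ → List ℕ → Set
Precedes a b w = ∃[ xs ] ∃[ ys ] (w ≡ xs ++ ys × a ∈ xs × b ∈ ys)

Representable12 : {V : Set} → List V → (V → V → Set) → Set
Representable12 {V} vs E =
  Σ (V → ℕ) λ ℓ →
    (∀ v → v ∈ vs → 0 < ℓ v) ×
    (∀ u v → u ∈ vs → v ∈ vs → ℓ u ≡ ℓ v → u ≡ v) ×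
    Σ (List ℕ) λ w →
      (∀ a → a ∈ w → ∃[ v ] (v ∈ vs × ℓ v ≡ a)) ×
      (∀ v → v ∈ vs → ℓ v ∈ w) ×
      (∀ u v → u ∈ vs → v ∈ vs → u ≢ v →
         ((¬ E u v) ⇔ Precedes (ℓ u ⊓ ℓ v) (ℓ u ⊔ ℓ v) w))

Point : Set
Point = ℤ × ℤ

Adj : Point → Point → Set
Adj (x₁ , y₁) (x₂ , y₂) = ∣ x₁ - x₂ ∣ Data.Nat.+ ∣ y₁ - y₂ ∣ ≡ 1
  where import Data.Nat

-- an induced subgraph of the grid is given by its (finite) vertex list;
-- edges are all grid edges between its vertices.

data Path (G : List Point) : Point → Point → Set where
  here : ∀ {p} → Path G p p
  step : ∀ {p q r} → Adj p q → q ∈ G → Path G q r → Path G p r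

Connected : List Point → Set
Connected G = ∀ p q → p ∈ G → q ∈ G → Path G p q

corners : Point → List Point
corners (x , y) =
  (x , y) ∷ (x ℤ.+ + 1 , y) ∷ (x , y ℤ.+ + 1) ∷ (x ℤ.+ + 1 , y ℤ.+ + 1) ∷ []

-- squares of G are identified by their lower-left corner
Square : List Point → Point → Set
Square G p = ∀ a → a ∈ corners p → a ∈ G

EndSquare : List Point → Point → Set
EndSquare G p =
  Square G p ×
  ∃[ a ] ∃[ b ] (a ∈ corners p × b ∈ corners p × Adj a b ×
    (∀ q → Square G q → q ≢ p → (a ∉ corners q × b ∉ corners q)))

ShareEdge : Point → Point → Set
ShareEdge p q = ∃[ a ] ∃[ b ] (Adj a b ×
  a ∈ corners p × b ∈ corners p × a ∈ corners q × b ∈ corners q)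

CornerNode : List Point → Point → Set
CornerNode G v =
  v ∈ G ×
  Σ Point λ s →
    Square G s × v ∈ corners s ×
    (∀ q → Square G q → v ∈ corners q → q ≡ s) ×
    (¬ EndSquare G s) ×
    ∃[ q₁ ] ∃[ q₂ ] (Square G q₁ × Square G q₂ ×
      q₁ ≢ s × q₂ ≢ s × q₁ ≢ q₂ × ShareEdge s q₁ × ShareEdge s q₂)

-- G' = u ∷ G is obtained by gluing a line of length 1 (new vertex u) to v
-- and is again an induced subgraph of the grid whose edges are those of G
-- plus vu: u is new, adjacent to v, and adjacent to no other vertex of G.
Glue1 : List Point → Point → Point → Set
Glue1 G v u = u ∉ G × Adj v u × (∀ w → w ∈ G → Adj w u → w ≡ v)

-- Around v, G′ contains as an induced subgraph a fixed nine-vertex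
-- configuration H: the square at v, the two squares across its sides opposite
-- v, and u.  The proof has four parts.
--  1. Words: "every a precedes every b" is an interval order on the letters of
--     a word (transitive, and satisfies Fishburn's 2+2 condition).
--  2. A 12-representation restricts to any induced subgraph as a witness: a
--     linear order ⊏ (labels) and an interval order ≺ that disagree exactly
--     on edges.
--  3. H has no witness: labels are never monotone along an induced 2-path,
--     which fixes the order on every edge once u ⊏ v (reversing both orders
--     otherwise), and five instances of Fishburn's condition close a cycle.
--  4. Geometry: a symmetry of the grid places H at v inside G′; the finite
--     facts about unit squares this needs are checked by evaluation.
module Submission where

open import Defs
open import Data.Bool using (Bool; true; false)
open import Data.Empty using (⊥; ⊥-elim)
open import Data.Integer as ℤ using (ℤ; +_; -[1+_]; ∣_∣)
open import Data.Integer.Properties as ℤₚ using (∣i-j∣≡∣j-i∣; ∣-i∣≡∣i∣; neg-distrib-+)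
open import Data.Integer.Tactic.RingSolver using (solve-∀)
open import Data.List using (List; []; _∷_; _++_)
open import Data.List.Membership.Propositional using (_∈_; _∉_)
open import Data.List.Membership.Propositional.Properties using (∈-++⁺ʳ; ∈-++⁻)
open import Data.List.Relation.Unary.Any using (Any; here; there; any?; satisfied)
open import Data.List.Relation.Unary.All using (All; all?; lookup)
open import Data.Nat as ℕ using (ℕ; suc; _<_; _⊓_; _⊔_)
open import Data.Nat.Properties as ℕₚ using (<-trans; <-irrefl; <-cmp; <⇒≤; <⇒≢; m≤n⇒m⊓n≡m; m≤n⇒m⊔n≡n)
open import Data.Product using (∃; _×_; _,_; proj₁; proj₂)
open import Data.Sum as Sum using (_⊎_; inj₁; inj₂; swap; [_,_])
open import Function using (_∘_; flip)
open import Function.Bundles using (_⇔_; Equivalence; mk⇔)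
open import Relation.Binary using (DecidableEquality; tri<; tri≈; tri>)
open import Relation.Binary.PropositionalEquality using (_≡_; _≢_; refl; sym; trans; cong; cong₂; subst; module ≡-Reasoning)
open import Relation.Nullary using (¬_; Dec; ¬?)
open import Relation.Nullary.Decidable using (from-yes; _→-dec_; _⊎-dec_)
open import Data.Product.Properties using (≡-dec)

precedes-∷ : ∀ {a b x w} → Precedes a b (x ∷ w) → (x ≡ a × b ∈ w) ⊎ Precedes a b w
precedes-∷ ([] , _ , _ , () , _)
precedes-∷ (_ ∷ xs , ys , refl , here refl , b∈ys) = inj₁ (refl , ∈-++⁺ʳ xs b∈ys)
precedes-∷ (_ ∷ xs , ys , refl , there a∈xs , b∈ys) = inj₂ (xs , ys , refl , a∈xs , b∈ys)

precedes-[] : ∀ {a b} → ¬ Precedes a b []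
precedes-[] ([] , _ , _ , () , _)
precedes-[] (_ ∷ _ , _ , () , _ , _)

precedes-head : ∀ {a b w} → b ∈ w → Precedes a b (a ∷ w)
precedes-head {a} {w = w} b∈w = a ∷ [] , w , refl , here refl , b∈w

precedes-tail : ∀ {a b x w} → Precedes a b w → Precedes a b (x ∷ w)
precedes-tail {x = x} (xs , ys , refl , a∈xs , b∈ys) = x ∷ xs , ys , refl , there a∈xs , b∈ys

precedes-∈-tail : ∀ {a b x w} → Precedes a b (x ∷ w) → b ∈ w
precedes-∈-tail p with precedes-∷ p
... | inj₁ (_ , b∈w) = b∈w
... | inj₂ (xs , _ , refl , _ , b∈ys) = ∈-++⁺ʳ xs b∈ys

-- Reading ¬ Precedes b a w as "all occurrences of a come before all
-- occurrences of b", this relation is transitive through any letter b that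
-- actually occurs in w ...
¬precedes-trans : ∀ {a b c} w → b ∈ w → ¬ Precedes b a w → ¬ Precedes c b w → ¬ Precedes c a w
¬precedes-trans (x ∷ w) (here refl) ¬ba _ ca = ¬ba (precedes-head (precedes-∈-tail ca))
¬precedes-trans (x ∷ w) (there b∈w) ¬ba ¬cb ca with precedes-∷ ca
... | inj₁ (refl , _) = ¬cb (precedes-head b∈w)
... | inj₂ ca′ = ¬precedes-trans w b∈w (¬ba ∘ precedes-tail) (¬cb ∘ precedes-tail) ca′

-- ... and it satisfies Fishburn's (2+2)-condition: if a is before b, c is
-- before d, and some d precedes some a, then c is before b.  Together these
-- say that the letters of a word are interval-ordered.
¬precedes-fishburn : ∀ {a b c d} w → ¬ Precedes b a w → ¬ Precedes d c w → Precedes d a w → ¬ Precedes b c w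
¬precedes-fishburn [] _ _ da _ = precedes-[] da
¬precedes-fishburn (x ∷ w) ¬ba ¬dc da bc with precedes-∷ bc | precedes-∷ da
... | inj₁ (refl , _) | _ = ¬ba (precedes-head (precedes-∈-tail da))
... | inj₂ bc′ | inj₁ (refl , _) = ¬dc (precedes-head (precedes-∈-tail (precedes-tail {x = x} bc′)))
... | inj₂ bc′ | inj₂ da′ = ¬precedes-fishburn w (¬ba ∘ precedes-tail) (¬dc ∘ precedes-tail) da′ bc′

-- A 12-representation of a graph F gives two relations on its vertices: the
-- order ⊏ of the labels (a strict linear order) and the relation x ≺ y, "all
-- occurrences of x come before all occurrences of y" (an interval order).
-- Adjacency is exactly disagreement of the two: for x ⊏ y, the vertices are
-- adjacent iff y ≺ x.
record Witness {W : Set} (F : W → W → Set) : Set₁ where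
  field
    _⊏_ _≺_    : W → W → Set
    ⊏-trans    : ∀ {x y z} → x ⊏ y → y ⊏ z → x ⊏ z
    ⊏-irrefl   : ∀ {x} → ¬ x ⊏ x
    ⊏-total    : ∀ {x y} → x ≢ y → x ⊏ y ⊎ y ⊏ x
    ≺-trans    : ∀ {x y z} → x ≺ y → y ≺ z → x ≺ z
    ≺-fishburn : ∀ {a b c d} → a ≺ b → c ≺ d → ¬ a ≺ d → c ≺ b
    edge       : ∀ {x y} → F x y → x ⊏ y → y ≺ x
    non-edge   : ∀ {x y} → x ≢ y → ¬ F x y → x ⊏ y → ¬ y ≺ x

-- Reversing both orders gives again a witness (for a symmetric graph); this
-- corresponds to complementing the labels and reversing the word.
dual : ∀ {W} {F : W → W → Set} → (∀ x y → F x y → F y x) → Witness F → Witness F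
dual F-sym M = record
  { _⊏_        = flip _⊏_
  ; _≺_        = flip _≺_
  ; ⊏-trans    = flip ⊏-trans
  ; ⊏-irrefl   = ⊏-irrefl
  ; ⊏-total    = swap ∘ ⊏-total
  ; ≺-trans    = flip ≺-trans
  ; ≺-fishburn = λ b≺a d≺c ¬d≺a → ≺-fishburn d≺c b≺a ¬d≺a
  ; edge       = λ xy y⊏x → edge (F-sym _ _ xy) y⊏x
  ; non-edge   = λ x≢y ¬xy y⊏x → non-edge (x≢y ∘ sym) (¬xy ∘ F-sym _ _) y⊏x
  }
  where open Witness M

-- Only the labels of the
-- embedded vertices matter; the word may contain further letters.
induced-witness : ∀ {V W : Set} {vs : List V} {E : V → V → Set} {F : W → W → Set}
  (ι : W → V) → (∀ x → ι x ∈ vs) → (∀ {x y} → ι x ≡ ι y → x ≡ y) →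
  (∀ {x y} → F x y ⇔ E (ι x) (ι y)) → Representable12 vs E → Witness F
induced-witness {W = W} {E = E} {F = F} ι ι∈vs ι-inj F⇔E (ℓ , _ , ℓ-inj , w , _ , ℓ∈w , rep) = record
  { _⊏_        = λ x y → label x < label y
  ; _≺_        = λ x y → ¬ Precedes (label y) (label x) w
  ; ⊏-trans    = <-trans
  ; ⊏-irrefl   = <-irrefl refl
  ; ⊏-total    = total
  ; ≺-trans    = λ {_} {y} x≺y y≺z → ¬precedes-trans w (ℓ∈w (ι y) (ι∈vs y)) x≺y y≺z
  ; ≺-fishburn = λ a≺b c≺d ¬a≺d bc → ¬a≺d (λ da → ¬precedes-fishburn w a≺b c≺d da bc)
  ; edge       = joined
  ; non-edge   = λ x≢y ¬xy lt ¬p → ¬p (separated x≢y ¬xy lt)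
  }
  where
  label : W → ℕ
  label x = ℓ (ι x)

  min-max : ∀ {m n} → m < n → Precedes (m ⊓ n) (m ⊔ n) w ≡ Precedes m n w
  min-max m<n = cong₂ (λ p q → Precedes p q w) (m≤n⇒m⊓n≡m (<⇒≤ m<n)) (m≤n⇒m⊔n≡n (<⇒≤ m<n))

  represents : ∀ {x y} → ι x ≢ ι y → label x < label y → ((¬ E (ι x) (ι y)) ⇔ Precedes (label x) (label y) w)
  represents {x} {y} ιx≢ιy lt =
    subst (λ P → (¬ E (ι x) (ι y)) ⇔ P) (min-max lt) (rep (ι x) (ι y) (ι∈vs x) (ι∈vs y) ιx≢ιy)

  joined : ∀ {x y} → F x y → label x < label y → ¬ Precedes (label x) (label y) w
  joined xy lt p = Equivalence.from (represents (<⇒≢ lt ∘ cong ℓ) lt) p (Equivalence.to F⇔E xy)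

  separated : ∀ {x y} → x ≢ y → ¬ F x y → label x < label y → Precedes (label x) (label y) w
  separated x≢y ¬xy lt = Equivalence.to (represents (x≢y ∘ ι-inj) lt) (¬xy ∘ Equivalence.from F⇔E)

  total : ∀ {x y} → x ≢ y → label x < label y ⊎ label y < label x
  total {x} {y} x≢y with <-cmp (label x) (label y)
  ... | tri< lt _ _ = inj₁ lt
  ... | tri≈ _ eq _ = ⊥-elim (x≢y (ι-inj (ℓ-inj (ι x) (ι y) (ι∈vs x) (ι∈vs y) eq)))
  ... | tri> _ _ gt = inj₂ gt

module WitnessProperties {W : Set} {F : W → W → Set} (F-sym : ∀ x y → F x y → F y x) (M : Witness F) where
  open Witness M

  no-monotone-path : ∀ {x y z} → F x y → F y z → ¬ F x z → x ≢ z → x ⊏ y → y ⊏ z → ⊥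
  no-monotone-path xy yz ¬xz x≢z x⊏y y⊏z =
    non-edge x≢z ¬xz (⊏-trans x⊏y y⊏z) (≺-trans (edge yz y⊏z) (edge xy x⊏y))

  peak : ∀ {x y z} → F x y → F y z → ¬ F x z → x ≢ z → y ≢ z → x ⊏ y → z ⊏ y
  peak xy yz ¬xz x≢z y≢z x⊏y with ⊏-total y≢z
  ... | inj₁ y⊏z = ⊥-elim (no-monotone-path xy yz ¬xz x≢z x⊏y y⊏z)
  ... | inj₂ z⊏y = z⊏y

  valley : ∀ {x y z} → F x y → F y z → ¬ F x z → x ≢ z → y ≢ z → y ⊏ x → y ⊏ z
  valley xy yz ¬xz x≢z y≢z y⊏x with ⊏-total y≢z
  ... | inj₁ y⊏z = y⊏z
  ... | inj₂ z⊏y = ⊥-elim (no-monotone-path (F-sym _ _ yz) (F-sym _ _ xy) (¬xz ∘ F-sym _ _) (x≢z ∘ sym) z⊏y y⊏x)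

  -- Fishburn's condition in graph terms: for edges ab and cd going down from
  -- a and c, if d lies below a (and d, a are non-adjacent), then c lies below b.
  crossing : ∀ {a b c d} → F a b → F c d → ¬ F d a → ¬ F b c → d ≢ a → b ≢ c →
    b ⊏ a → d ⊏ c → d ⊏ a → c ⊏ b
  crossing {a} {b} {c} {d} ab cd ¬da ¬bc d≢a b≢c b⊏a d⊏c d⊏a with ⊏-total b≢c
  ... | inj₂ c⊏b = c⊏b
  ... | inj₁ b⊏c = ⊥-elim (non-edge b≢c ¬bc b⊏c (≺-fishburn a≺b c≺d ¬a≺d))
    where
    a≺b : a ≺ b
    a≺b = edge (F-sym _ _ ab) b⊏a
    c≺d : c ≺ d
    c≺d = edge (F-sym _ _ cd) d⊏c
    ¬a≺d : ¬ a ≺ d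
    ¬a≺d = non-edge d≢a ¬da d⊏a

  cycle : ∀ {x y z t} → x ⊏ y → y ⊏ z → z ⊏ t → t ⊏ x → ⊥
  cycle x⊏y y⊏z z⊏t t⊏x = ⊏-irrefl (⊏-trans (⊏-trans x⊏y y⊏z) (⊏-trans z⊏t t⊏x))

origin : Point
origin = + 0 , + 0

_⊕_ _⊖_ : Point → Point → Point
(x , y) ⊕ (i , j) = x ℤ.+ i , y ℤ.+ j
(x , y) ⊖ (i , j) = x ℤ.- i , y ℤ.- j

-- taxicab length; Adj p q is by definition norm (p ⊖ q) ≡ 1
norm : Point → ℕ
norm (i , j) = ∣ i ∣ ℕ.+ ∣ j ∣

norm-⊖-comm : ∀ p q → norm (p ⊖ q) ≡ norm (q ⊖ p)
norm-⊖-comm (x , y) (i , j) = cong₂ ℕ._+_ (∣i-j∣≡∣j-i∣ x i) (∣i-j∣≡∣j-i∣ y j)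

Adj-sym : ∀ p q → Adj p q → Adj q p
Adj-sym p q = trans (norm-⊖-comm q p)

-- The configuration: three squares around a corner node v, and u glued to v
--
--   g h
--   b c f
-- u v a e

module Configuration where

  data Nine : Set where
    u v a b c e f g h : Nine

  std : Nine → Point
  std u = -[1+ 0 ] , + 0
  std v = + 0 , + 0
  std a = + 1 , + 0
  std b = + 0 , + 1
  std c = + 1 , + 1
  std e = + 2 , + 0
  std f = + 2 , + 1
  std g = + 0 , + 2
  std h = + 1 , + 2

  nine : List Nine
  nine = u ∷ v ∷ a ∷ b ∷ c ∷ e ∷ f ∷ g ∷ h ∷ []

  ∈-nine : ∀ x → x ∈ nine
  ∈-nine u = here refl
  ∈-nine v = there (here refl)
  ∈-nine a = there (there (here refl))
  ∈-nine b = there (there (there (here refl)))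
  ∈-nine c = there (there (there (there (here refl))))
  ∈-nine e = there (there (there (there (there (here refl)))))
  ∈-nine f = there (there (there (there (there (there (here refl))))))
  ∈-nine g = there (there (there (there (there (there (there (here refl)))))))
  ∈-nine h = there (there (there (there (there (there (there (there (here refl))))))))

  decode : Point → Nine
  decode (-[1+ 0 ] , + 0) = u
  decode (+ 1 , + 0) = a
  decode (+ 0 , + 1) = b
  decode (+ 1 , + 1) = c
  decode (+ 2 , + 0) = e
  decode (+ 2 , + 1) = f
  decode (+ 0 , + 2) = g
  decode (+ 1 , + 2) = h
  decode _ = v

  decode-std : ∀ x → decode (std x) ≡ x
  decode-std u = refl
  decode-std v = refl
  decode-std a = refl
  decode-std b = refl
  decode-std c = refl
  decode-std e = refl
  decode-std f = refl
  decode-std g = refl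
  decode-std h = refl

  std-injective : ∀ {x y} → std x ≡ std y → x ≡ y
  std-injective {x} {y} eq = trans (sym (decode-std x)) (trans (cong decode eq) (decode-std y))

  Grid : Nine → Nine → Set
  Grid x y = Adj (std x) (std y)

  Grid-sym : ∀ x y → Grid x y → Grid y x
  Grid-sym x y = Adj-sym (std x) (std y)

  -- With u below v, the local extremum rule fixes the order along every
  -- edge, and five instances of Fishburn's condition then force a cycle in
  -- the label order, however the pairs (c,u), (b,e) and (a,g) are ordered.
  oriented : (M : Witness Grid) → Witness._⊏_ M u v → ⊥
  oriented M u⊏v = [ c⊏u-case , u⊏c-case ] (⊏-total {c} {u} (λ ()))
    where
    open Witness M
    open WitnessProperties Grid-sym M

    a⊏v : a ⊏ v
    a⊏v = peak {u} refl refl (λ ()) (λ ()) (λ ()) u⊏v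
    b⊏v : b ⊏ v
    b⊏v = peak {u} refl refl (λ ()) (λ ()) (λ ()) u⊏v
    a⊏c : a ⊏ c
    a⊏c = valley {v} refl refl (λ ()) (λ ()) (λ ()) a⊏v
    a⊏e : a ⊏ e
    a⊏e = valley {v} refl refl (λ ()) (λ ()) (λ ()) a⊏v
    b⊏g : b ⊏ g
    b⊏g = valley {v} refl refl (λ ()) (λ ()) (λ ()) b⊏v
    f⊏c : f ⊏ c
    f⊏c = peak {a} refl refl (λ ()) (λ ()) (λ ()) a⊏c
    h⊏c : h ⊏ c
    h⊏c = peak {a} refl refl (λ ()) (λ ()) (λ ()) a⊏c
    f⊏e : f ⊏ e
    f⊏e = peak {a} refl refl (λ ()) (λ ()) (λ ()) a⊏e
    h⊏g : h ⊏ g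
    h⊏g = peak {b} refl refl (λ ()) (λ ()) (λ ()) b⊏g

    u⊏c⇒v⊏f : u ⊏ c → v ⊏ f
    u⊏c⇒v⊏f = crossing {c} {f} {v} {u} refl refl (λ ()) (λ ()) (λ ()) (λ ()) f⊏c u⊏v
    u⊏c⇒v⊏h : u ⊏ c → v ⊏ h
    u⊏c⇒v⊏h = crossing {c} {h} {v} {u} refl refl (λ ()) (λ ()) (λ ()) (λ ()) h⊏c u⊏v
    b⊏e⇒g⊏a : b ⊏ e → g ⊏ a
    b⊏e⇒g⊏a = crossing {e} {a} {g} {b} refl refl (λ ()) (λ ()) (λ ()) (λ ()) a⊏e b⊏g
    b⊏e⇒v⊏f : b ⊏ e → v ⊏ f
    b⊏e⇒v⊏f = crossing {e} {f} {v} {b} refl refl (λ ()) (λ ()) (λ ()) (λ ()) f⊏e b⊏v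
    a⊏g⇒v⊏h : a ⊏ g → v ⊏ h
    a⊏g⇒v⊏h = crossing {g} {h} {v} {a} refl refl (λ ()) (λ ()) (λ ()) (λ ()) h⊏g a⊏v

    u⊏c-case : u ⊏ c → ⊥
    u⊏c-case u⊏c = [ (λ b⊏e → cycle (b⊏e⇒g⊏a b⊏e) a⊏v (u⊏c⇒v⊏h u⊏c) h⊏g)
                   , (λ e⊏b → cycle e⊏b b⊏v (u⊏c⇒v⊏f u⊏c) f⊏e)
                   ] (⊏-total {b} {e} (λ ()))

    c⊏u-case : c ⊏ u → ⊥
    c⊏u-case c⊏u = [ (λ b⊏e → cycle c⊏u u⊏v (b⊏e⇒v⊏f b⊏e) f⊏c)
                   , (λ e⊏b → [ (λ a⊏g → cycle c⊏u u⊏v (a⊏g⇒v⊏h a⊏g) h⊏c)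
                              , (λ g⊏a → cycle e⊏b b⊏g g⊏a a⊏e)
                              ] (⊏-total {a} {g} (λ ())))
                   ] (⊏-total {b} {e} (λ ()))

  -- The configuration has no 12-representation: reversing both orders if
  -- necessary, u lies below v.
  no-witness : ¬ Witness Grid
  no-witness M with Witness.⊏-total M {u} {v} (λ ())
  ... | inj₁ u⊏v = oriented M u⊏v
  ... | inj₂ v⊏u = oriented (dual Grid-sym M) v⊏u

open Configuration using (Nine; std; nine; ∈-nine; std-injective; Grid; no-witness)

⊕-assoc : ∀ p q r → (p ⊕ q) ⊕ r ≡ p ⊕ (q ⊕ r)
⊕-assoc (x , y) (i , j) (k , l) = cong₂ _,_ (ℤₚ.+-assoc x i k) (ℤₚ.+-assoc y j l)

⊕-identityʳ : ∀ p → p ⊕ origin ≡ p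
⊕-identityʳ (x , y) = cong₂ _,_ (ℤₚ.+-identityʳ x) (ℤₚ.+-identityʳ y)

⊕-⊖-translate : ∀ o p q → (o ⊕ p) ⊖ (o ⊕ q) ≡ p ⊖ q
⊕-⊖-translate (x , y) (i , j) (k , l) = cong₂ _,_ (lemma x i k) (lemma y j l)
  where
  lemma : ∀ x i k → (x ℤ.+ i) ℤ.- (x ℤ.+ k) ≡ i ℤ.- k
  lemma = solve-∀

⊕-⊖-assoc : ∀ p q r → (p ⊕ q) ⊖ r ≡ p ⊕ (q ⊖ r)
⊕-⊖-assoc (x , y) (i , j) (k , l) = cong₂ _,_ (ℤₚ.+-assoc x i (ℤ.- k)) (ℤₚ.+-assoc y j (ℤ.- l))

⊕-⊖-cancel : ∀ p q → (p ⊕ q) ⊖ q ≡ p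
⊕-⊖-cancel (x , y) (i , j) = cong₂ _,_ (lemma x i) (lemma y j)
  where
  lemma : ∀ x i → (x ℤ.+ i) ℤ.- i ≡ x
  lemma = solve-∀

⊕-⊖-difference : ∀ p q → p ⊕ (q ⊖ p) ≡ q
⊕-⊖-difference (x , y) (i , j) = cong₂ _,_ (lemma x i) (lemma y j)
  where
  lemma : ∀ x i → x ℤ.+ (i ℤ.- x) ≡ i
  lemma = solve-∀

⊕-⊖-cancelˡ : ∀ o p → (o ⊕ p) ⊖ o ≡ p
⊕-⊖-cancelˡ (x , y) (i , j) = cong₂ _,_ (lemma x i) (lemma y j)
  where
  lemma : ∀ x i → (x ℤ.+ i) ℤ.- x ≡ i
  lemma = solve-∀

⊕-cancelˡ : ∀ o {p q} → o ⊕ p ≡ o ⊕ q → p ≡ q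
⊕-cancelˡ o {p} {q} eq = trans (sym (⊕-⊖-cancelˡ o p)) (trans (cong (_⊖ o) eq) (⊕-⊖-cancelˡ o q))

solve-base : ∀ {q s} x y → q ⊕ x ≡ s ⊕ y → q ≡ s ⊕ (y ⊖ x)
solve-base {q} {s} x y eq = begin
  q              ≡⟨ sym (⊕-⊖-cancel q x) ⟩
  (q ⊕ x) ⊖ x    ≡⟨ cong (_⊖ x) eq ⟩
  (s ⊕ y) ⊖ x    ≡⟨ ⊕-⊖-assoc s y x ⟩
  s ⊕ (y ⊖ x)    ∎
  where open ≡-Reasoning

norm-self : ∀ p → norm (p ⊖ p) ≡ 0
norm-self (x , y) = cong₂ ℕ._+_ (cong ∣_∣ (ℤₚ.+-inverseʳ x)) (cong ∣_∣ (ℤₚ.+-inverseʳ y))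

norm-zero : ∀ p q → norm (p ⊖ q) ≡ 0 → p ≡ q
norm-zero (x , y) (i , j) eq = cong₂ _,_ (component x i (ℕₚ.m+n≡0⇒m≡0 _ eq)) (component y j (ℕₚ.m+n≡0⇒n≡0 _ eq))
  where
  component : ∀ x i → ∣ x ℤ.- i ∣ ≡ 0 → x ≡ i
  component x i d = ℤₚ.i-j≡0⇒i≡j x i (ℤₚ.∣i∣≡0⇒i≡0 d)

-- the eight symmetries of the grid fixing the origin: optionally exchange
-- the coordinates, then optionally negate each of them
record Frame : Set where
  constructor frame
  field
    exchange flipX flipY : Bool

negateIf : Bool → ℤ → ℤ
negateIf true i = ℤ.- i
negateIf false i = i

act : Frame → Point → Point
act (frame false s t) (i , j) = negateIf s i , negateIf t j
act (frame true s t) (i , j) = negateIf s j , negateIf t i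

frames : List Frame
frames = frame false false false ∷ frame false false true ∷ frame false true false ∷ frame false true true ∷
         frame true false false ∷ frame true false true ∷ frame true true false ∷ frame true true true ∷ []

∣negateIf-difference∣ : ∀ s i j → ∣ negateIf s i ℤ.- negateIf s j ∣ ≡ ∣ i ℤ.- j ∣
∣negateIf-difference∣ false i j = refl
∣negateIf-difference∣ true i j = trans (cong ∣_∣ (sym (neg-distrib-+ i (ℤ.- j)))) (∣-i∣≡∣i∣ (i ℤ.- j))

act-isometry : ∀ φ p q → norm (act φ p ⊖ act φ q) ≡ norm (p ⊖ q)
act-isometry (frame false s t) (i , j) (k , l) =
  cong₂ ℕ._+_ (∣negateIf-difference∣ s i k) (∣negateIf-difference∣ t j l)
act-isometry (frame true s t) (i , j) (k , l) =
  trans (cong₂ ℕ._+_ (∣negateIf-difference∣ s j l) (∣negateIf-difference∣ t i k)) (ℕₚ.+-comm ∣ j ℤ.- l ∣ ∣ i ℤ.- k ∣)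

place : Point → Frame → Nine → Point
place o φ x = o ⊕ act φ (std x)

place-isometry : ∀ o φ x y → norm (place o φ x ⊖ place o φ y) ≡ norm (std x ⊖ std y)
place-isometry o φ x y = trans (cong norm (⊕-⊖-translate o (act φ (std x)) (act φ (std y)))) (act-isometry φ (std x) (std y))

place-adjacency : ∀ o φ {x y} → Grid x y ⇔ Adj (place o φ x) (place o φ y)
place-adjacency o φ {x} {y} = mk⇔ (trans (place-isometry o φ x y)) (trans (sym (place-isometry o φ x y)))

place-injective : ∀ o φ {x y} → place o φ x ≡ place o φ y → x ≡ y
place-injective o φ {x} {y} eq = std-injective (norm-zero (std x) (std y) (begin
  norm (std x ⊖ std y)                 ≡⟨ sym (place-isometry o φ x y) ⟩
  norm (place o φ x ⊖ place o φ y)     ≡⟨ cong (λ p → norm (place o φ x ⊖ p)) (sym eq) ⟩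
  norm (place o φ x ⊖ place o φ x)     ≡⟨ norm-self (place o φ x) ⟩
  0                                    ∎))
  where open ≡-Reasoning

-- the four unit steps, the relative positions of the squares sharing an edge
-- with a given square (including the square itself), and the unit square
steps shifts unit : List Point
steps = (+ 1 , + 0) ∷ (-[1+ 0 ] , + 0) ∷ (+ 0 , + 1) ∷ (+ 0 , -[1+ 0 ]) ∷ []
shifts = origin ∷ steps
unit = corners origin

corner-offset : ∀ {p q} → p ∈ corners q → ∃ λ δ → δ ∈ unit × p ≡ q ⊕ δ
corner-offset {q = q} (here refl) = origin , here refl , sym (⊕-identityʳ q)
corner-offset {q = x , y} (there (here refl)) =
  (+ 1 , + 0) , there (here refl) , cong (x ℤ.+ + 1 ,_) (sym (ℤₚ.+-identityʳ y))
corner-offset {q = x , y} (there (there (here refl))) =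
  (+ 0 , + 1) , there (there (here refl)) , cong (_, y ℤ.+ + 1) (sym (ℤₚ.+-identityʳ x))
corner-offset (there (there (there (here refl)))) = (+ 1 , + 1) , there (there (there (here refl))) , refl

corner-shift : ∀ o {δ t} → δ ∈ corners t → o ⊕ δ ∈ corners (o ⊕ t)
corner-shift o (here refl) = here refl
corner-shift (x , y) {t = i , j} (there (here refl)) =
  there (here (cong (_, y ℤ.+ j) (sym (ℤₚ.+-assoc x i (+ 1)))))
corner-shift (x , y) {t = i , j} (there (there (here refl))) =
  there (there (here (cong (x ℤ.+ i ,_) (sym (ℤₚ.+-assoc y j (+ 1))))))
corner-shift (x , y) {t = i , j} (there (there (there (here refl)))) =
  there (there (there (here (cong₂ _,_ (sym (ℤₚ.+-assoc x i (+ 1))) (sym (ℤₚ.+-assoc y j (+ 1)))))))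

square-member : ∀ {G} o {t δ} → Square G (o ⊕ t) → δ ∈ corners t → o ⊕ δ ∈ G
square-member o sq δ∈t = sq _ (corner-shift o δ∈t)

unit-step : ∀ t → norm t ≡ 1 → t ∈ steps
unit-step (+ 0 , + 0) ()
unit-step (+ 0 , + 1) _ = there (there (here refl))
unit-step (+ 0 , + (suc (suc n))) ()
unit-step (+ 0 , -[1+ 0 ]) _ = there (there (there (here refl)))
unit-step (+ 0 , -[1+ suc n ]) ()
unit-step (+ 1 , + 0) _ = here refl
unit-step (+ 1 , + (suc n)) ()
unit-step (+ 1 , -[1+ n ]) ()
unit-step (+ (suc (suc m)) , j) ()
unit-step (-[1+ 0 ] , + 0) _ = there (here refl)
unit-step (-[1+ 0 ] , + (suc n)) ()
unit-step (-[1+ 0 ] , -[1+ n ]) ()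
unit-step (-[1+ suc m ] , j) ()

neighbour : ∀ {p q} → Adj p q → ∃ λ t → t ∈ steps × q ≡ p ⊕ t
neighbour {p} {q} adj = q ⊖ p , unit-step (q ⊖ p) (trans (norm-⊖-comm q p) adj) , sym (⊕-⊖-difference p q)

-- Finite facts about unit squares are established by evaluating a decision
-- procedure; they are kept abstract so that later proofs never unfold them.

_≟ₚ_ : DecidableEquality Point
_≟ₚ_ = ≡-dec ℤ._≟_ ℤ._≟_

open import Data.List.Membership.DecPropositional _≟ₚ_ using (_∈?_)

adj? : ∀ p q → Dec (Adj p q)
adj? p q = norm (p ⊖ q) ℕ.≟ 1

-- If adjacent corners α, β of the unit square are the corners α′, β′ of a
-- common translate of it, that translation is one of the shifts.
abstract
  edge-translations : All (λ α → All (λ β → All (λ α′ → All (λ β′ →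
    Adj α β → α ⊖ α′ ≡ β ⊖ β′ → α ⊖ α′ ∈ shifts) unit) unit) unit) unit
  edge-translations = from-yes (all? (λ α → all? (λ β → all? (λ α′ → all? (λ β′ →
    adj? α β →-dec ((α ⊖ α′) ≟ₚ (β ⊖ β′) →-dec ((α ⊖ α′) ∈? shifts))) unit) unit) unit) unit)

-- the squares across the two sides of the unit square not containing the
-- corner d
away : ℤ → ℤ
away (+ 0) = + 1
away _ = -[1+ 0 ]

besideX besideY : Point → Point
besideX (i , j) = away i , + 0
besideY (i , j) = + 0 , away j

-- A square sharing an edge with the unit square, other than it and not
-- containing its corner d, is one of the two squares beside it away from d.
abstract
  squares-away : All (λ d → All (λ t → t ≢ origin → d ∉ corners t → t ≡ besideX d ⊎ t ≡ besideY d) shifts) unit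
  squares-away = from-yes (all? (λ d → all? (λ t →
    ¬? (t ≟ₚ origin) →-dec (¬? (d ∈? corners t) →-dec ((t ≟ₚ besideX d) ⊎-dec (t ≟ₚ besideY d)))) shifts) unit)

block : Point → List Point
block d = unit ++ corners (besideX d) ++ corners (besideY d)

-- For a corner d and a unit step t leading out of the unit square, some
-- symmetry places the configuration at d inside the three squares and d ⊕ t.
abstract
  placements : All (λ d → All (λ t → d ⊕ t ∉ unit →
    Any (λ φ → All (λ x → d ⊕ act φ (std x) ∈ (d ⊕ t) ∷ block d) nine) frames) steps) unit
  placements = from-yes (all? (λ d → all? (λ t → ¬? ((d ⊕ t) ∈? unit) →-dec
    any? (λ φ → all? (λ x → (d ⊕ act φ (std x)) ∈? ((d ⊕ t) ∷ block d)) nine) frames) steps) unit)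

shared-edge : ∀ {s q} → ShareEdge s q → ∃ λ t → t ∈ shifts × q ≡ s ⊕ t
shared-edge {s} {q} (_ , _ , adj , p∈s , r∈s , p∈q , r∈q)
  with corner-offset p∈s | corner-offset r∈s | corner-offset p∈q | corner-offset r∈q
... | α , α∈ , refl | β , β∈ , refl | α′ , α′∈ , p≡ | β′ , β′∈ , r≡ =
  α ⊖ α′ , lookup (lookup (lookup (lookup edge-translations α∈) β∈) α′∈) β′∈ α~β same , q≡
  where
  q≡ : q ≡ s ⊕ (α ⊖ α′)
  q≡ = solve-base {q} {s} α′ α (sym p≡)
  same : α ⊖ α′ ≡ β ⊖ β′
  same = ⊕-cancelˡ s (trans (sym q≡) (solve-base {q} {s} β′ β (sym r≡)))
  α~β : Adj α β
  α~β = trans (sym (cong norm (⊕-⊖-translate s α β))) adj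

distinct-pair : ∀ {A : Set} {P : A → Set} {x y p q : A} →
  p ≡ x ⊎ p ≡ y → q ≡ x ⊎ q ≡ y → p ≢ q → P p → P q → P x × P y
distinct-pair (inj₁ refl) (inj₁ refl) p≢q _ _ = ⊥-elim (p≢q refl)
distinct-pair (inj₁ refl) (inj₂ refl) _ Pp Pq = Pp , Pq
distinct-pair (inj₂ refl) (inj₁ refl) _ Pp Pq = Pq , Pp
distinct-pair (inj₂ refl) (inj₂ refl) p≢q _ _ = ⊥-elim (p≢q refl)

-- Around a corner node v, with u glued to it, the configuration can be
-- placed at v so that all its points lie in G′ = u ∷ G: v is the corner d
-- of its square s, the two other squares are the ones beside s away from d,
-- and u is a unit step out of s.
standard-position : ∀ {G v u} → CornerNode G v → Glue1 G v u → ∃ λ φ → ∀ x → place v φ x ∈ u ∷ G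
standard-position {G} {v} {u} (_ , s , sq , v∈s , unique , _ , _ , _ , sq₁ , sq₂ , q₁≢s , q₂≢s , q₁≢q₂ , sh₁ , sh₂) (u∉G , vu , _)
  with corner-offset v∈s | neighbour {v} {u} vu
... | d , d∈unit , refl | t , t∈steps , refl =
  φ , λ x → subst (_∈ _) (sym (⊕-assoc s d (act φ (std x)))) (located (lookup inside (∈-nine x)))
  where
  sq₀ : Square G (s ⊕ origin)
  sq₀ = subst (Square G) (sym (⊕-identityʳ s)) sq

  leaves : d ⊕ t ∉ unit
  leaves dt∈unit = u∉G (subst (_∈ G) (sym (⊕-assoc s d t)) (square-member s sq₀ dt∈unit))

  beside : ∀ {q} → Square G q → q ≢ s → ShareEdge s q → q ≡ s ⊕ besideX d ⊎ q ≡ s ⊕ besideY d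
  beside sqq q≢s sh with shared-edge sh
  ... | r , r∈shifts , refl = Sum.map (cong (s ⊕_)) (cong (s ⊕_))
    (lookup (lookup squares-away d∈unit) r∈shifts (λ { refl → q≢s (⊕-identityʳ s) })
      (λ d∈r → q≢s (unique (s ⊕ r) sqq (corner-shift s d∈r))))

  placed : ∃ λ φ → All (λ x → d ⊕ act φ (std x) ∈ (d ⊕ t) ∷ block d) nine
  placed = satisfied (lookup (lookup placements d∈unit) t∈steps leaves)

  φ : Frame
  φ = proj₁ placed

  inside : All (λ x → d ⊕ act φ (std x) ∈ (d ⊕ t) ∷ block d) nine
  inside = proj₂ placed

  sqX×sqY : Square G (s ⊕ besideX d) × Square G (s ⊕ besideY d)
  sqX×sqY = distinct-pair {P = Square G} (beside sq₁ q₁≢s sh₁) (beside sq₂ q₂≢s sh₂) q₁≢q₂ sq₁ sq₂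

  located : ∀ {r} → r ∈ (d ⊕ t) ∷ block d → s ⊕ r ∈ ((s ⊕ d) ⊕ t) ∷ G
  located (here refl) = here (sym (⊕-assoc s d t))
  located (there r∈block) with ∈-++⁻ unit r∈block
  ... | inj₁ r∈unit = there (square-member s sq₀ r∈unit)
  ... | inj₂ r∈sides with ∈-++⁻ (corners (besideX d)) r∈sides
  ...   | inj₁ r∈X = there (square-member s (proj₁ sqX×sqY) r∈X)
  ...   | inj₂ r∈Y = there (square-member s (proj₂ sqX×sqY) r∈Y)

proposition29 : (G : List Point) (v u : Point) →
    Connected G → CornerNode G v → Glue1 G v u →
    ¬ Representable12 (u ∷ G) Adj
proposition29 G v u _ corner glue rep with standard-position corner glue
... | φ , inside = no-witness (induced-witness (place v φ) inside (place-injective v φ) (place-adjacency v φ) rep)
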